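{- Let ParAlg be nice with traps, $G$ a parity game, $\sigma$ a player and $\lambda$ an integer. Suppose $X$ is a nonempty $\sigma$-trap in $G$ whose largest priority $m$ satisfies $m<\lambda$ and $\mathrm{ParAlg}(G[X],\sigma)=\emptyset$. If $Y$ is a vertex set with $X\cap Y=\emptyset$, then $X\cap\mathrm{GenAttr}(G,\lambda,Y,\sigma,\mathrm{ParAlg})=\emptyset$.
   Context: A parity game $G=(V,E,p)$: finite directed graph in which every vertex has an outgoing edge, priorities $p:V\to\mathbb Z$; even-priority vertices belong to Even, odd ones to Odd; $V_\sigma$ the vertices of $\sigma$, $\overline\sigma$ the opponent, $N(v)$ the successors of $v$. A $\sigma$-trap is a set $X$ in which every $\sigma$-vertex has all successors in $X$ and every $\overline\sigma$-vertex has some successor in $X$; $G[X]$ is the induced subgraph. ParAlg (mapping a parity game and player to a vertex subset) is nice with traps if: (i) for every parity game $G$ and $\overline\sigma$-trap $A$, $\mathrm{ParAlg}(G[A],\sigma)\subseteq\mathrm{ParAlg}(G,\sigma)$; (ii) with $S=\mathrm{ParAlg}(G,\sigma)$, for every $\overline\sigma$-trap $A\supseteq S$, $\mathrm{ParAlg}(G[A],\sigma)=S$, and for every $\sigma$-trap $A$ with $A\cap S\ne\emptyset$, $\mathrm{ParAlg}(G[A],\sigma)\ne\emptyset$; (iii) $\mathrm{ParAlg}(G,\sigma)$ is always a $\overline\sigma$-trap whose largest priority belongs to $\sigma$. $\mathrm{Attr}(G,X,\sigma)$ is the least $C\supseteq X$ containing every $v\in V_\sigma$ with $N(v)\cap C\ne\emptyset$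 and every $v\in V_{\overline\sigma}$ with $N(v)\subseteq C$. $\mathrm{SafeAttr}(G,\lambda,X,\sigma)$ is the least $C\supseteq X$ containing every $v\in V_\sigma$ with $p(v)<\lambda$ and $N(v)\cap C\ne\emptyset$ and every $v\in V_{\overline\sigma}$ with $p(v)<\lambda$ and $N(v)\subseteq C$. $\mathrm{Restrict}(G,\lambda,\sigma)=V\setminus\mathrm{Attr}(G,\{v:p(v)\ge\lambda\},\overline\sigma)$. $\mathrm{GenAttr}(G,\lambda,X,\sigma,\mathrm{ParAlg})$: $C:=X$; repeatedly $S:=\mathrm{SafeAttr}(G,\lambda,C,\sigma)$, $V':=\mathrm{Restrict}(G[V\setminus S],\lambda,\sigma)$, $C':=S\cup\mathrm{ParAlg}(G[V'],\sigma)$; return $C'$ if $C'=C$, else $C:=C'$. -}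

module Defs where

open import Data.Nat using (ℕ; zero; suc)
open import Data.Integer using (ℤ; ∣_∣; _<_; _≤_; _<?_; _≤?_)
open import Data.Bool using (Bool; true; false; _∧_; _∨_; not; if_then_else_)
open import Data.Fin using (Fin; zero; suc)
open import Data.Fin.Subset using (Subset; _∈_; _⊆_; _∩_; _∪_; _─_; Nonempty; Empty)
open import Data.Vec using (Vec; tabulate; lookup)
open import Data.Vec.Properties using (≡-dec)
import Data.Bool.Properties as BoolP
open import Data.Product using (Σ; ∃; _×_; _,_)
open import Relation.Binary.PropositionalEquality using (_≡_)
open import Relation.Nullary using (yes; no)
open import Relation.Nullary.Decidable using (⌊_⌋)

data Player : Set where
  Even Odd : Player

opp : Player → Player
opp Even = Odd
opp Odd  = Even

samePlayer : Player → Player → Bool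
samePlayer Even Even = true
samePlayer Odd  Odd  = true
samePlayer _    _    = false

parityℕ : ℕ → Player
parityℕ zero          = Even
parityℕ (suc zero)    = Odd
parityℕ (suc (suc k)) = parityℕ k

parityℤ : ℤ → Player
parityℤ z = parityℕ ∣ z ∣

-- The vertex set of a game is a subset  V  of the ambient
-- universe  Fin n ; this makes induced subgames  G[X]  games over the
-- same universe (replace V by X).  Edges/priorities outside V are
-- irrelevant junk.

record Game (n : ℕ) : Set where
  field
    V : Subset n
    E : Fin n → Fin n → Bool
    p : Fin n → ℤ

open Game public

module _ {n : ℕ} (G : Game n) where

  Owns : Player → Fin n → Set
  Owns σ v = v ∈ V G × parityℤ (p G v) ≡ σ

  IsParityGame : Set
  IsParityGame = ∀ v → v ∈ V G → ∃ λ w → w ∈ V G × E G v w ≡ true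

  IsTrap : Player → Subset n → Set
  IsTrap σ X =
      X ⊆ V G
    × (∀ v → v ∈ X → Owns σ v → ∀ w → w ∈ V G → E G v w ≡ true → w ∈ X)
    × (∀ v → v ∈ X → Owns (opp σ) v → ∃ λ w → w ∈ X × E G v w ≡ true)

  LargestPriorityBelongsTo : Player → Subset n → Set
  LargestPriorityBelongsTo σ S =
    Nonempty S → ∃ λ v → v ∈ S × (∀ w → w ∈ S → p G w ≤ p G v) × parityℤ (p G v) ≡ σ

_[_] : ∀ {n} → Game n → Subset n → Game n
G [ X ] = record { V = X ; E = E G ; p = p G }

ParAlgType : Set
ParAlgType = ∀ {n} → Game n → Player → Subset n

record NiceWithTraps (ParAlg : ParAlgType) : Set where
  field
    nice-i   : ∀ {n} (G : Game n) → IsParityGame G → ∀ σ (A : Subset n) →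
               IsTrap G (opp σ) A → ParAlg (G [ A ]) σ ⊆ ParAlg G σ
    nice-ii₁ : ∀ {n} (G : Game n) → IsParityGame G → ∀ σ (A : Subset n) →
               IsTrap G (opp σ) A → ParAlg G σ ⊆ A →
               ParAlg (G [ A ]) σ ≡ ParAlg G σ
    nice-ii₂ : ∀ {n} (G : Game n) → IsParityGame G → ∀ σ (A : Subset n) →
               IsTrap G σ A → Nonempty (A ∩ ParAlg G σ) →
               Nonempty (ParAlg (G [ A ]) σ)
    nice-iii : ∀ {n} (G : Game n) → IsParityGame G → ∀ σ →
               IsTrap G (opp σ) (ParAlg G σ)
               × LargestPriorityBelongsTo G σ (ParAlg G σ)

anyF : ∀ {n} → (Fin n → Bool) → Bool
anyF {zero}  f = false
anyF {suc n} f = f zero ∨ anyF (λ i → f (suc i))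

allF : ∀ {n} → (Fin n → Bool) → Bool
allF {zero}  f = true
allF {suc n} f = f zero ∧ allF (λ i → f (suc i))

iterate : ∀ {A : Set} → ℕ → (A → A) → A → A
iterate zero    f a = a
iterate (suc k) f a = iterate k f (f a)

module _ {n : ℕ} (G : Game n) where

  ownsB : Player → Fin n → Bool
  ownsB σ v = lookup (V G) v ∧ samePlayer (parityℤ (p G v)) σ

  someSuccIn : Subset n → Fin n → Bool
  someSuccIn C v = anyF (λ w → lookup (V G) w ∧ E G v w ∧ lookup C w)

  allSuccIn : Subset n → Fin n → Bool
  allSuccIn C v = allF (λ w → not (lookup (V G) w ∧ E G v w) ∨ lookup C w)

  -- one step of the (safe) attractor computation; `ok v` is the extra
  -- side condition on vertices that may be added
  attrStep : (Fin n → Bool) → Player → Subset n → Subset n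
  attrStep ok σ C = tabulate λ v →
    lookup C v ∨ (ok v ∧ ((ownsB σ v ∧ someSuccIn C v)
                       ∨ (ownsB (opp σ) v ∧ allSuccIn C v)))

  -- Attr(G,X,σ): least fixed point above X, reached after at most n+1
  -- iterations of the monotone inflationary step
  Attr : Subset n → Player → Subset n
  Attr X σ = iterate (suc n) (attrStep (λ _ → true) σ) X

  SafeAttr : ℤ → Subset n → Player → Subset n
  SafeAttr lam X σ = iterate (suc n) (attrStep (λ v → ⌊ p G v <? lam ⌋) σ) X

  atLeast : ℤ → Subset n
  atLeast lam = tabulate λ v → lookup (V G) v ∧ ⌊ lam ≤? p G v ⌋

  Restrict : ℤ → Player → Subset n
  Restrict lam σ = V G ─ Attr (atLeast lam) (opp σ)

-- GenAttr(G,λ,X,σ,ParAlg): the loop, run with fuel n+1 (the sets C are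
-- increasing, so the loop terminates within n+1 rounds)
module _ (ParAlg : ParAlgType) {n : ℕ} (G : Game n) (lam : ℤ) (σ : Player) where

  genStep : Subset n → Subset n
  genStep C =
    let S  = SafeAttr G lam C σ
        V′ = Restrict (G [ V G ─ S ]) lam σ
    in S ∪ ParAlg (G [ V′ ]) σ

  genLoop : ℕ → Subset n → Subset n
  genLoop zero    C = C
  genLoop (suc k) C with ≡-dec BoolP._≟_ (genStep C) C
  ... | yes _ = genStep C
  ... | no  _ = genLoop k (genStep C)

GenAttr : ParAlgType → ∀ {n} → Game n → ℤ → Subset n → Player → Subset n
GenAttr ParAlg {n} G lam X σ = genLoop ParAlg G lam σ (suc (suc n)) X

-- Every set that GenAttr builds from Y stays disjoint from X.  The σ-safe
-- attractor never enters the σ-trap X: a σ-vertex of X has no edge leaving X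
-- and an opponent vertex of X always has an edge into X.  For the ParAlg part,
-- a vertex of X found by ParAlg on G[V′] would lie in B = X ∩ V′, which is a
-- σ-trap of G[V′] and an opponent trap of G[X]; niceness (ii) makes
-- ParAlg(G[B], σ) nonempty and niceness (i) puts it inside ParAlg(G[X], σ) = ∅.
module Submission where

open import Defs
open import Data.Integer using (ℤ; _<_; _≤_)
open import Data.Fin.Subset using (Subset; _∈_; _⊆_; _∩_; Empty)
open import Relation.Binary.PropositionalEquality using (_≡_)
open import Data.Product using (∃; _×_)

open import Data.Bool using (Bool; true; false; T; _∧_; _∨_; not)
open import Data.Bool.Properties using (T-≡; T-∧; T-∨)
import Data.Bool.Properties as Bool
open import Data.Empty using (⊥-elim)
open import Data.Fin using (Fin; zero; suc)
open import Data.Fin.Properties using (¬∀⟶∃¬)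
open import Data.Fin.Subset using (_∉_; _─_; _⊂_; ∣_∣; Nonempty; outside)
open import Data.Fin.Subset.Properties
  using (_∈?_; _⊂?_; ⊆-antisym; ∣p∣≤n; p⊂q⇒∣p∣<∣q∣; ∩-comm; p∩q⊆p; x∈p∩q⁺; x∈p∩q⁻;
         x∈p∪q⁻; x∈p∧x∉q⇒x∈p─q; p─q⊆p)
open import Data.Integer.Properties using (≰⇒>)
open import Data.Nat using (ℕ; zero; suc; _+_) renaming (_<_ to _<ℕ_)
import Data.Nat.Properties as ℕ
open import Data.Product using (_,_; proj₁; proj₂)
open import Data.Sum using (_⊎_; inj₁; inj₂; [_,_])
open import Data.Vec using (_∷_; lookup; here; there)
open import Data.Vec.Properties using (lookup∘tabulate; []=⇒lookup; lookup⇒[]=; ≡-dec)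
open import Function using (_∘_)
open import Function.Bundles using (Equivalence)
open import Relation.Nullary using (Dec; yes; no; ¬_)
open import Relation.Nullary.Decidable using (fromWitness; decidable-stable; _→-dec_)
open import Relation.Binary.PropositionalEquality using (refl; sym; subst; subst₂)

open Equivalence using (to; from)

∈⇒T-lookup : ∀ {n} {p : Subset n} {v} → v ∈ p → T (lookup p v)
∈⇒T-lookup v∈p = from T-≡ ([]=⇒lookup v∈p)

T-lookup⇒∈ : ∀ {n} {p : Subset n} {v} → T (lookup p v) → v ∈ p
T-lookup⇒∈ {p = p} {v} t = lookup⇒[]= v p (to T-≡ t)

x∈p─q⇒x∉q : ∀ {n} {p q : Subset n} {x} → x ∈ p ─ q → x ∉ q
x∈p─q⇒x∉q {p = _ ∷ _} {outside ∷ _} here        ()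
x∈p─q⇒x∉q {p = _ ∷ _} {_ ∷ _}       (there x∈) (there x∈q) = x∈p─q⇒x∉q x∈ x∈q

counterexample : ∀ {A B C : Set} → Dec A → Dec B → ¬ (A → B → C) → A × B × ¬ C
counterexample (yes a) (yes b) ¬f = a , b , λ c → ¬f λ _ _ → c
counterexample (yes _) (no ¬b) ¬f = ⊥-elim (¬f λ _ b → ⊥-elim (¬b b))
counterexample (no ¬a) _       ¬f = ⊥-elim (¬f λ a → ⊥-elim (¬a a))

anyF-intro : ∀ {n} (f : Fin n → Bool) i → T (f i) → T (anyF f)
anyF-intro f zero    t = from T-∨ (inj₁ t)
anyF-intro f (suc i) t = from T-∨ (inj₂ (anyF-intro (f ∘ suc) i t))

anyF-elim : ∀ {n} (f : Fin n → Bool) → T (anyF f) → ∃ λ i → T (f i)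
anyF-elim {suc n} f t with to T-∨ t
... | inj₁ t₀ = zero , t₀
... | inj₂ t₁ with anyF-elim (f ∘ suc) t₁
...   | i , tᵢ = suc i , tᵢ

allF-intro : ∀ {n} (f : Fin n → Bool) → (∀ i → T (f i)) → T (allF f)
allF-intro {zero}  f h = _
allF-intro {suc n} f h = from T-∧ (h zero , allF-intro (f ∘ suc) (h ∘ suc))

allF-elim : ∀ {n} (f : Fin n → Bool) → T (allF f) → ∀ i → T (f i)
allF-elim {suc n} f t zero    = proj₁ (to T-∧ t)
allF-elim {suc n} f t (suc i) = allF-elim (f ∘ suc) (proj₂ (to T-∧ t)) i

T-not-∨⁺ : ∀ {b c} → (T b → T c) → T (not b ∨ c)
T-not-∨⁺ {false} _ = _
T-not-∨⁺ {true}  h = h _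

T-not-∨⁻ : ∀ {b c} → T (not b ∨ c) → T b → T c
T-not-∨⁻ {true} t _ = t

opp-involutive : ∀ σ → opp (opp σ) ≡ σ
opp-involutive Even = refl
opp-involutive Odd  = refl

player-cases : ∀ ρ σ → ρ ≡ σ ⊎ ρ ≡ opp σ
player-cases Even Even = inj₁ refl
player-cases Even Odd  = inj₂ refl
player-cases Odd  Even = inj₂ refl
player-cases Odd  Odd  = inj₁ refl

samePlayer-refl : ∀ σ → T (samePlayer σ σ)
samePlayer-refl Even = _
samePlayer-refl Odd  = _

samePlayer⇒≡ : ∀ ρ σ → T (samePlayer ρ σ) → ρ ≡ σ
samePlayer⇒≡ Even Even _ = refl
samePlayer⇒≡ Odd  Odd  _ = refl

iterate-preserves : ∀ {A : Set} (P : A → Set) {f : A → A} →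
                    (∀ {a} → P a → P (f a)) → ∀ k {a} → P a → P (iterate k f a)
iterate-preserves P pres zero    Pa = Pa
iterate-preserves P pres (suc k) Pa = iterate-preserves P pres k (pres Pa)

module _ {n : ℕ} {f : Subset n → Subset n} (inflationary : ∀ C → C ⊆ f C) where

  iterate-inflationary : ∀ k C → C ⊆ iterate k f C
  iterate-inflationary k C = iterate-preserves (C ⊆_) (λ C⊆D → inflationary _ ∘ C⊆D) k (λ x∈C → x∈C)

  stable-or-grows : ∀ C → f C ⊆ C ⊎ C ⊂ f C
  stable-or-grows C with C ⊂? f C
  ... | yes C⊂fC = inj₂ C⊂fC
  ... | no  C⊄fC = inj₁ λ {x} x∈fC →
          decidable-stable (x ∈? C) λ x∉C → C⊄fC (inflationary C , x , x∈fC , x∉C)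

  iterate-stable : ∀ {C} → f C ≡ C → ∀ k → iterate k f C ≡ C
  iterate-stable fC≡C zero    = refl
  iterate-stable fC≡C (suc k) rewrite fC≡C = iterate-stable fC≡C k

  -- A round that does not close C strictly enlarges it, which happens at most n ∸ ∣ C ∣ times.
  iterate-closed-after : ∀ k C → n <ℕ ∣ C ∣ + k → f (iterate k f C) ⊆ iterate k f C
  iterate-closed-after zero C n<∣C∣+0 =
    ⊥-elim (ℕ.<⇒≱ (subst (n <ℕ_) (ℕ.+-identityʳ ∣ C ∣) n<∣C∣+0) (∣p∣≤n C))
  iterate-closed-after (suc k) C n<∣C∣+1+k with stable-or-grows C
  ... | inj₁ fC⊆C =
          subst (λ D → f D ⊆ D) (sym (iterate-stable (⊆-antisym fC⊆C (inflationary C)) (suc k))) fC⊆C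
  ... | inj₂ C⊂fC = iterate-closed-after k (f C)
          (ℕ.≤-trans n<∣C∣+1+k (ℕ.≤-trans (ℕ.≤-reflexive (ℕ.+-suc ∣ C ∣ k))
                                           (ℕ.+-monoˡ-≤ k (p⊂q⇒∣p∣<∣q∣ C⊂fC))))

  iterate-closed : ∀ C → f (iterate (suc n) f C) ⊆ iterate (suc n) f C
  iterate-closed C = iterate-closed-after (suc n) C (ℕ.m≤n+m (suc n) ∣ C ∣)

Disjoint : ∀ {n} → Subset n → Subset n → Set
Disjoint X C = ∀ {v} → v ∈ X → v ∉ C

Empty-∩⇒Disjoint : ∀ {n} {X C : Subset n} → Empty (X ∩ C) → Disjoint X C
Empty-∩⇒Disjoint X∩C≡∅ v∈X v∈C = X∩C≡∅ (_ , x∈p∩q⁺ (v∈X , v∈C))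

Disjoint⇒Empty-∩ : ∀ {n} {X C : Subset n} → Disjoint X C → Empty (X ∩ C)
Disjoint⇒Empty-∩ {X = X} {C} X∩C≡∅ (v , v∈X∩C) = let v∈X , v∈C = x∈p∩q⁻ X C v∈X∩C in X∩C≡∅ v∈X v∈C

module _ {n : ℕ} (H : Game n) where

  Attracts : Player → Subset n → Fin n → Set
  Attracts τ C v = (Owns H τ v × ∃ λ w → w ∈ V H × E H v w ≡ true × w ∈ C)
                 ⊎ (Owns H (opp τ) v × ∀ w → w ∈ V H → E H v w ≡ true → w ∈ C)

  ownsB⁺ : ∀ {τ v} → Owns H τ v → T (ownsB H τ v)
  ownsB⁺ {τ} (v∈V , refl) = from T-∧ (∈⇒T-lookup v∈V , samePlayer-refl τ)

  ownsB⁻ : ∀ {τ v} → T (ownsB H τ v) → Owns H τ v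
  ownsB⁻ {τ} t = T-lookup⇒∈ (proj₁ (to T-∧ t)) , samePlayer⇒≡ _ τ (proj₂ (to T-∧ t))

  attracts⁺ : ∀ {τ C v} → Attracts τ C v →
    T ((ownsB H τ v ∧ someSuccIn H C v) ∨ (ownsB H (opp τ) v ∧ allSuccIn H C v))
  attracts⁺ (inj₁ (owns , w , w∈V , vw , w∈C)) =
    from T-∨ (inj₁ (from T-∧ (ownsB⁺ owns ,
      anyF-intro _ w (from T-∧ (∈⇒T-lookup w∈V , from T-∧ (from T-≡ vw , ∈⇒T-lookup w∈C))))))
  attracts⁺ (inj₂ (owns , all∈C)) =
    from T-∨ (inj₂ (from T-∧ (ownsB⁺ owns , allF-intro _ λ w → T-not-∨⁺ λ t →
      let w∈V , vw = to T-∧ t in ∈⇒T-lookup (all∈C w (T-lookup⇒∈ w∈V) (to T-≡ vw)))))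

  attracts⁻ : ∀ {τ C v} →
    T ((ownsB H τ v ∧ someSuccIn H C v) ∨ (ownsB H (opp τ) v ∧ allSuccIn H C v)) → Attracts τ C v
  attracts⁻ t with to T-∨ t
  ... | inj₁ t₁ =
          let owns , some = to T-∧ t₁
              w , tw = anyF-elim _ some
              w∈V , rest = to T-∧ tw
              vw , w∈C = to T-∧ rest
          in inj₁ (ownsB⁻ owns , w , T-lookup⇒∈ w∈V , to T-≡ vw , T-lookup⇒∈ w∈C)
  ... | inj₂ t₂ =
          let owns , all = to T-∧ t₂
          in inj₂ (ownsB⁻ owns , λ w w∈V vw →
               T-lookup⇒∈ (T-not-∨⁻ (allF-elim _ all w) (from T-∧ (∈⇒T-lookup w∈V , from T-≡ vw))))

  module _ (ok : Fin n → Bool) (τ : Player) where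

    attrStep-inflationary : ∀ C → C ⊆ attrStep H ok τ C
    attrStep-inflationary C {v} v∈C =
      T-lookup⇒∈ (subst T (sym (lookup∘tabulate _ v)) (from T-∨ (inj₁ (∈⇒T-lookup v∈C))))

    attrStep-∈⁺ : ∀ {C v} → T (ok v) → Attracts τ C v → v ∈ attrStep H ok τ C
    attrStep-∈⁺ {v = v} okv att =
      T-lookup⇒∈ (subst T (sym (lookup∘tabulate _ v)) (from T-∨ (inj₂ (from T-∧ (okv , attracts⁺ att)))))

    attrStep-∈⁻ : ∀ {C v} → v ∈ attrStep H ok τ C → v ∈ C ⊎ Attracts τ C v
    attrStep-∈⁻ {v = v} v∈ with to T-∨ (subst T (lookup∘tabulate _ v) (∈⇒T-lookup v∈))
    ... | inj₁ v∈C = inj₁ (T-lookup⇒∈ v∈C)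
    ... | inj₂ t   = inj₂ (attracts⁻ (proj₂ (to T-∧ t)))

    attrStep-closed : ∀ C → attrStep H ok τ (iterate (suc n) (attrStep H ok τ) C)
                              ⊆ iterate (suc n) (attrStep H ok τ) C
    attrStep-closed = iterate-closed attrStep-inflationary

    closed⇒escape : ∀ {C v} → attrStep H ok τ C ⊆ C → T (ok v) → Owns H (opp τ) v → v ∉ C →
                    ∃ λ w → w ∈ V H × E H v w ≡ true × w ∉ C
    closed⇒escape {C} {v} closed okv owns v∉C =
      let w , ¬stays = ¬∀⟶∃¬ n _ (λ w → (w ∈? V H) →-dec ((E H v w Bool.≟ true) →-dec (w ∈? C)))
                         λ all∈C → v∉C (closed (attrStep-∈⁺ okv (inj₂ (owns , all∈C))))
      in w , counterexample (w ∈? V H) (E H v w Bool.≟ true) ¬stays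

    closed-complement-isTrap : ∀ {C} → attrStep H ok τ C ⊆ C → (∀ v → T (ok v)) → IsTrap H τ (V H ─ C)
    closed-complement-isTrap {C} closed always =
        p─q⊆p (V H) C
      , (λ v v∉C owns w w∈V vw → x∈p∧x∉q⇒x∈p─q w∈V λ w∈C →
           x∈p─q⇒x∉q v∉C (closed (attrStep-∈⁺ (always v) (inj₁ (owns , w , w∈V , vw , w∈C)))))
      , (λ v v∉C owns → let w , w∈V , vw , w∉C = closed⇒escape closed (always v) owns (x∈p─q⇒x∉q v∉C)
                        in w , x∈p∧x∉q⇒x∈p─q w∈V w∉C , vw)

  attrStep-preserves-disjoint-trap : ∀ {σ X C} ok → IsTrap H σ X → Disjoint X C →
                                     Disjoint X (attrStep H ok σ C)
  attrStep-preserves-disjoint-trap {σ} ok (X⊆V , σ-stays , opp-stays) X∩C≡∅ v∈X v∈step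
    with attrStep-∈⁻ ok σ v∈step
  ... | inj₁ v∈C = X∩C≡∅ v∈X v∈C
  ... | inj₂ (inj₁ (owns , w , w∈V , vw , w∈C)) = X∩C≡∅ (σ-stays _ v∈X owns w w∈V vw) w∈C
  ... | inj₂ (inj₂ (owns , all∈C)) =
          let w , w∈X , vw = opp-stays _ v∈X owns in X∩C≡∅ w∈X (all∈C w (X⊆V w∈X) vw)

  trap-restrict : ∀ {τ X U} → IsTrap H τ X → X ⊆ U → U ⊆ V H → IsTrap (H [ U ]) τ X
  trap-restrict (X⊆V , τ-stays , opp-stays) X⊆U U⊆V =
      X⊆U
    , (λ v v∈X (_ , par) w w∈U → τ-stays v v∈X (X⊆V v∈X , par) w (U⊆V w∈U))
    , (λ v v∈X (_ , par) → opp-stays v v∈X (X⊆V v∈X , par))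

  trap-isParityGame : ∀ {τ X} → IsTrap H τ X →
                      (∀ v → v ∈ X → Owns H τ v → ∃ λ w → w ∈ V H × E H v w ≡ true) →
                      IsParityGame (H [ X ])
  trap-isParityGame {τ} (X⊆V , τ-stays , opp-stays) τ-moves v v∈X with player-cases (parityℤ (p H v)) τ
  ... | inj₁ par = let w , w∈V , vw = τ-moves v v∈X (X⊆V v∈X , par)
                   in w , τ-stays v v∈X (X⊆V v∈X , par) w w∈V vw , vw
  ... | inj₂ par = opp-stays v v∈X (X⊆V v∈X , par)

  -- σ̄ cannot leave T because T is a σ̄-trap; σ's move inside T stays in X because X is a σ-trap.
  trap-∩-subgame : ∀ {σ X T} → IsTrap H σ X → IsTrap H (opp σ) T → IsTrap (H [ X ]) (opp σ) (X ∩ T)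
  trap-∩-subgame {σ} {X} {T} (X⊆V , σ-stays , _) (T⊆V , opp-stays , σ-escapes) =
      p∩q⊆p X T
    , (λ v v∈X∩T (_ , par) w w∈X vw →
         let v∈X , v∈T = x∈p∩q⁻ X T v∈X∩T
         in x∈p∩q⁺ (w∈X , opp-stays v v∈T (X⊆V v∈X , par) w (X⊆V w∈X) vw))
    , (λ v v∈X∩T (_ , par) →
         let v∈X , v∈T = x∈p∩q⁻ X T v∈X∩T
             w , w∈T , vw = σ-escapes v v∈T (X⊆V v∈X , par)
             σ-owns = X⊆V v∈X , subst (parityℤ (p H v) ≡_) (opp-involutive σ) par
         in w , x∈p∩q⁺ (σ-stays v v∈X σ-owns w (T⊆V w∈T) vw , w∈T) , vw)

  trap-∩-subgameʳ : ∀ {σ X T} → IsTrap H σ X → IsTrap H (opp σ) T → IsTrap (H [ T ]) σ (X ∩ T)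
  trap-∩-subgameʳ {σ} {X} {T} Xtrap Ttrap =
    subst₂ (λ ρ B → IsTrap (H [ T ]) ρ B) (opp-involutive σ) (∩-comm T X)
      (trap-∩-subgame Ttrap (subst (λ ρ → IsTrap H ρ X) (sym (opp-involutive σ)) Xtrap))

ParAlg-disjoint-from-trap : ∀ {ParAlg : ParAlgType} → NiceWithTraps ParAlg →
  ∀ {n} {H : Game n} {σ X T} → IsTrap H σ X → IsTrap H (opp σ) T →
  IsParityGame (H [ X ]) → IsParityGame (H [ T ]) → Empty (ParAlg (H [ X ]) σ) →
  Disjoint X (ParAlg (H [ T ]) σ)
ParAlg-disjoint-from-trap {ParAlg} nice {H = H} {σ} {X} {T} Xtrap Ttrap pgX pgT nothing-on-X {v} v∈X v∈P =
  nothing-on-X (proj₁ nonempty , found-in-X (proj₂ nonempty))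
  where
    open NiceWithTraps nice
    v∈T : v ∈ T
    v∈T = proj₁ (proj₁ (nice-iii (H [ T ]) pgT σ)) v∈P
    found-in-X : ParAlg (H [ X ∩ T ]) σ ⊆ ParAlg (H [ X ]) σ
    found-in-X = nice-i (H [ X ]) pgX σ (X ∩ T) (trap-∩-subgame H Xtrap Ttrap)
    nonempty : Nonempty (ParAlg (H [ X ∩ T ]) σ)
    nonempty = nice-ii₂ (H [ T ]) pgT σ (X ∩ T) (trap-∩-subgameʳ H Xtrap Ttrap)
                 (v , x∈p∩q⁺ (x∈p∩q⁺ (v∈X , v∈T) , v∈P))

atLeast-∈⁺ : ∀ {n} (H : Game n) {lam v} → v ∈ V H → lam ≤ p H v → v ∈ atLeast H lam
atLeast-∈⁺ H {v = v} v∈V lam≤pv =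
  T-lookup⇒∈ (subst T (sym (lookup∘tabulate _ v)) (from T-∧ (∈⇒T-lookup v∈V , fromWitness lam≤pv)))

Restrict-isTrap : ∀ {n} (H : Game n) lam σ → IsTrap H (opp σ) (Restrict H lam σ)
Restrict-isTrap H lam σ =
  closed-complement-isTrap H _ (opp σ) (attrStep-closed H _ (opp σ) (atLeast H lam)) (λ _ → _)

-- Outside Attr({p ≥ λ}) every opponent vertex has p < λ, so being outside the
-- σ-safe attractor gives it an edge that avoids that attractor.
Restrict-SafeAttr-isParityGame : ∀ {n} (G : Game n) lam σ C →
  IsParityGame (G [ Restrict (G [ V G ─ SafeAttr G lam C σ ]) lam σ ])
Restrict-SafeAttr-isParityGame {n} G lam σ C =
  trap-isParityGame G∖S (Restrict-isTrap G∖S lam σ) opponent-moves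
  where
    S = SafeAttr G lam C σ
    G∖S = G [ V G ─ S ]
    opponent-moves : ∀ v → v ∈ Restrict G∖S lam σ → Owns G∖S (opp σ) v →
                     ∃ λ w → w ∈ V G∖S × E G v w ≡ true
    opponent-moves v v∈V′ (v∈V∖S , par) =
      let pv<lam = ≰⇒> λ lam≤pv → x∈p─q⇒x∉q v∈V′
                     (iterate-inflationary (attrStep-inflationary G∖S _ (opp σ)) (suc n) _
                        (atLeast-∈⁺ G∖S v∈V∖S lam≤pv))
          w , w∈V , vw , w∉S = closed⇒escape G _ σ (attrStep-closed G _ σ C) (fromWitness pv<lam)
                                 (p─q⊆p (V G) S v∈V∖S , par) (x∈p─q⇒x∉q v∈V∖S)
      in w , x∈p∧x∉q⇒x∈p─q w∈V w∉S , vw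

module _ {ParAlg : ParAlgType} (nice : NiceWithTraps ParAlg) {n} {G : Game n} (pg : IsParityGame G)
         {σ : Player} (lam : ℤ) {X : Subset n} (Xtrap : IsTrap G σ X)
         (nothing-on-X : Empty (ParAlg (G [ X ]) σ)) where

  SafeAttr-disjoint : ∀ {C} → Disjoint X C → Disjoint X (SafeAttr G lam C σ)
  SafeAttr-disjoint = iterate-preserves (Disjoint X) (attrStep-preserves-disjoint-trap G _ Xtrap) (suc n)

  genStep-disjoint : ∀ {C} → Disjoint X C → Disjoint X (genStep ParAlg G lam σ C)
  genStep-disjoint {C} X∩C≡∅ v∈X v∈step = [ X∩S≡∅ v∈X , X∩P≡∅ v∈X ] (x∈p∪q⁻ S _ v∈step)
    where
      S = SafeAttr G lam C σ
      X∩S≡∅ = SafeAttr-disjoint X∩C≡∅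
      X⊆V∖S : X ⊆ V G ─ S
      X⊆V∖S w∈X = x∈p∧x∉q⇒x∈p─q (proj₁ Xtrap w∈X) (X∩S≡∅ w∈X)
      pgX : IsParityGame (G [ X ])
      pgX = trap-isParityGame G Xtrap λ w w∈X _ → pg w (proj₁ Xtrap w∈X)
      X∩P≡∅ : Disjoint X (ParAlg (G [ Restrict (G [ V G ─ S ]) lam σ ]) σ)
      X∩P≡∅ = ParAlg-disjoint-from-trap nice (trap-restrict G Xtrap X⊆V∖S (p─q⊆p (V G) S))
                (Restrict-isTrap (G [ V G ─ S ]) lam σ) pgX (Restrict-SafeAttr-isParityGame G lam σ C)
                nothing-on-X

  genLoop-disjoint : ∀ k {C} → Disjoint X C → Disjoint X (genLoop ParAlg G lam σ k C)
  genLoop-disjoint zero    X∩C≡∅ = X∩C≡∅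
  genLoop-disjoint (suc k) {C} X∩C≡∅ with ≡-dec Bool._≟_ (genStep ParAlg G lam σ C) C
  ... | yes _ = genStep-disjoint X∩C≡∅
  ... | no  _ = genLoop-disjoint k (genStep-disjoint X∩C≡∅)

mainTheorem16 : (ParAlg : ParAlgType) → NiceWithTraps ParAlg →
    ∀ {n} (G : Game n) → IsParityGame G → (σ : Player) (lam : ℤ) →
    (X : Subset n) → IsTrap G σ X →
    (m : ℤ) → (∃ λ v → v ∈ X × p G v ≡ m) → (∀ w → w ∈ X → p G w ≤ m) →
    m < lam →
    Empty (ParAlg (G [ X ]) σ) →
    (Y : Subset n) → Y ⊆ V G → Empty (X ∩ Y) →
    Empty (X ∩ GenAttr ParAlg G lam Y σ)
mainTheorem16 _ nice {n} _ pg _ lam _ Xtrap _ _ _ _ nothing-on-X _ _ X∩Y≡∅ =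
  Disjoint⇒Empty-∩
    (genLoop-disjoint nice pg lam Xtrap nothing-on-X (suc (suc n)) (Empty-∩⇒Disjoint X∩Y≡∅))
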